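{- Let $S$ be a connected graph. Then every connected $S$-free graph $G$ satisfies $\kappa'(G)=\delta(G)$ if and only if $S$ is an induced subgraph of $P_4$.
   Context: All graphs are finite and simple. A graph $G$ is $S$-free if $G$ contains no induced subgraph isomorphic to $S$. $\kappa'(G)$ denotes the edge-connectivity of $G$ (minimum number of edges whose removal disconnects $G$) and $\delta(G)$ its minimum degree. $P_i$ denotes the path with $i$ vertices. -}

module Defs where

open import Data.Nat using (ℕ; zero; suc; _+_; _≤_; _<_; _<ᵇ_; _≡ᵇ_)
open import Data.Fin using (Fin; toℕ; zero; suc)
open import Data.Bool using (Bool; true; false; _∧_; _∨_; not; if_then_else_)
open import Data.Bool.Properties using (∨-comm)
open import Data.List using (List; map; concatMap)
open import Data.Nat.ListAction using (sum)
open import Data.List.Base using (allFin)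
open import Data.Product using (Σ; _×_; _,_; ∃)
open import Data.Sum using (_⊎_)
open import Relation.Nullary using (¬_)
open import Relation.Binary.PropositionalEquality using (_≡_; refl)
open import Function.Definitions using (Injective)

record Graph : Set where
  field
    n     : ℕ
    adj   : Fin n → Fin n → Bool
    sym   : ∀ i j → adj i j ≡ adj j i
    irr   : ∀ i → adj i i ≡ false
open Graph public

data Reach {m : ℕ} (a : Fin m → Fin m → Bool) : Fin m → Fin m → Set where
  here : ∀ {u} → Reach a u u
  step : ∀ {u w v} → a u w ≡ true → Reach a w v → Reach a u v

ConnectedAdj : (m : ℕ) → (Fin m → Fin m → Bool) → Set
ConnectedAdj m a = (0 < m) × (∀ u v → Reach a u v)

Connected : Graph → Set
Connected G = ConnectedAdj (n G) (adj G)

_≼_ : Graph → Graph → Set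
S ≼ G = Σ (Fin (n S) → Fin (n G)) λ f →
          Injective _≡_ _≡_ f × (∀ i j → adj S i j ≡ adj G (f i) (f j))

Free : Graph → Graph → Set
Free S G = ¬ (S ≼ G)

deg : (G : Graph) → Fin (n G) → ℕ
deg G v = sum (map (λ w → if adj G v w then 1 else 0) (allFin (n G)))

IsMinDegree : Graph → ℕ → Set
IsMinDegree G d = (∃ λ v → deg G v ≡ d) × (∀ v → d ≤ deg G v)

-- An edge set F is given by a Bool marker on ordered pairs; the edge {i,j}
-- of G is removed iff F i j ∨ F j i.
marked : (G : Graph) → (Fin (n G) → Fin (n G) → Bool) → Fin (n G) → Fin (n G) → Bool
marked G F i j = adj G i j ∧ (F i j ∨ F j i)

removedCount : (G : Graph) → (Fin (n G) → Fin (n G) → Bool) → ℕ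
removedCount G F =
  sum (concatMap (λ i → map (λ j → if (toℕ i <ᵇ toℕ j) ∧ marked G F i j then 1 else 0)
                            (allFin (n G)))
                 (allFin (n G)))

deleteAdj : (G : Graph) → (Fin (n G) → Fin (n G) → Bool) → Fin (n G) → Fin (n G) → Bool
deleteAdj G F i j = adj G i j ∧ not (F i j ∨ F j i)

Disconnects : (G : Graph) → (Fin (n G) → Fin (n G) → Bool) → Set
Disconnects G F = ¬ ConnectedAdj (n G) (deleteAdj G F)

-- k = κ'(G): the minimum number of edges whose removal disconnects G;
-- by the usual convention κ'(K₁) = 0 (no edge set disconnects K₁).
IsEdgeConnectivity : Graph → ℕ → Set
IsEdgeConnectivity G k =
  ((Σ _ λ F → Disconnects G F × removedCount G F ≡ k)
     × (∀ F → Disconnects G F → k ≤ removedCount G F))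
  ⊎ ((n G ≡ 1) × (k ≡ 0))

EdgeConnEqMinDeg : Graph → Set
EdgeConnEqMinDeg G = ∀ k d → IsEdgeConnectivity G k → IsMinDegree G d → k ≡ d

p4adj : Fin 4 → Fin 4 → Bool
p4adj i j = (suc (toℕ i) ≡ᵇ toℕ j) ∨ (suc (toℕ j) ≡ᵇ toℕ i)

p4irr : ∀ i → p4adj i i ≡ false
p4irr zero = refl
p4irr (suc zero) = refl
p4irr (suc (suc zero)) = refl
p4irr (suc (suc (suc zero))) = refl

P₄ : Graph
P₄ = record { n = 4 ; adj = p4adj
            ; sym = λ i j → ∨-comm (suc (toℕ i) ≡ᵇ toℕ j) (suc (toℕ j) ≡ᵇ toℕ i)
            ; irr = p4irr }

module Submission where

-- Sufficiency.  Let G be connected and P₄-free with minimum degree d.  The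
-- edges at a vertex of degree d form a disconnecting set, so κ' ≤ d.  If F
-- disconnects G then (classically) the component of some vertex in G − F is a
-- nonempty proper vertex set Z whose boundary ∂Z lies in F, and |∂Z| ≤ |F| by
-- counting ordered pairs.  Since a connected P₄-free graph has diameter ≤ 2,
-- Z or its complement consists of vertices that all have a neighbour on the
-- other side; for such a set |∂Z| ≥ |Z| · max(1, d − |Z| + 1) ≥ d.
--
-- Necessity.  "Two triangles joined by a bridge" and "two squares joined by a
-- bridge" are connected with κ' = 1 < 2 = δ, so S embeds in both.  The second
-- makes S triangle-free, and a connected triangle-free induced subgraph of the
-- first embeds in P₄.  As S ≼ P₄ is decidable, the double negation suffices.

open import Defs hiding (sym)
open import Data.Nat using (ℕ; zero; suc; _+_; _*_; _∸_; _≤_; _<_; _<ᵇ_; _≡ᵇ_; z≤n; s≤s; _≤?_)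
open import Data.Nat.Properties
open import Data.Fin using (Fin; toℕ; zero; suc; #_) renaming (_≟_ to _≟F_)
open import Data.Fin.Properties using (any?; all?; ¬∀⟶∃¬; toℕ-injective; toℕ<n; sequence)
open import Data.Bool using (Bool; true; false; _∧_; _∨_; not; if_then_else_; T)
open import Data.Bool.Properties using (∨-comm; ∧-identityʳ; ∧-zeroʳ) renaming (_≟_ to _≟B_)
open import Data.List using (List; []; _∷_; map; concatMap; tabulate)
open import Data.List.Base using (allFin)
open import Data.Vec.Functional using () renaming (_∷_ to _◂_)
open import Data.List.Properties using (map-tabulate)
open import Data.Nat.ListAction using (sum)
open import Data.Nat.ListAction.Properties using (sum-++)
open import Data.Product using (Σ; _×_; _,_; ∃; proj₁; proj₂)
open import Data.Sum using (_⊎_; inj₁; inj₂)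
open import Data.Empty using (⊥; ⊥-elim)
open import Data.Unit using (tt)
open import Algebra.Properties.CommutativeSemigroup +-commutativeSemigroup
  using () renaming (interchange to +-interchange)
open import Effect.Monad using (RawMonad)
open import Function using (_∘_)
open import Function.Definitions using (Injective)
open import Relation.Nullary using (¬_; Dec; yes; no; does)
open import Relation.Nullary.Decidable using (from-yes; decidable-stable; _→-dec_; _×-dec_; _⊎-dec_; ¬?)
open import Relation.Nullary.Negation using (¬¬-Monad; ¬¬-map)
open import Relation.Nullary.Decidable.Core using (¬¬-excluded-middle)
open import Relation.Binary.PropositionalEquality
  using (_≡_; _≢_; refl; sym; trans; cong; cong₂; subst; subst₂; module ≡-Reasoning)

¬¬-all : ∀ {m} {P : Fin m → Set} → (∀ i → ¬ ¬ P i) → ¬ ¬ (∀ i → P i)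
¬¬-all = sequence (RawMonad.rawApplicative ¬¬-Monad)

∑ : (n : ℕ) → (Fin n → ℕ) → ℕ
∑ zero    f = 0
∑ (suc n) f = f zero + ∑ n (f ∘ suc)

∑² : (n : ℕ) → (Fin n → Fin n → ℕ) → ℕ
∑² n h = ∑ n (λ i → ∑ n (h i))

indicator : Bool → ℕ
indicator x = if x then 1 else 0

size : ∀ {n} → (Fin n → Bool) → ℕ
size {n} Z = ∑ n (indicator ∘ Z)

sum-allFin : ∀ n (f : Fin n → ℕ) → sum (map f (allFin n)) ≡ ∑ n f
sum-allFin n f = trans (cong sum (map-tabulate (λ i → i) f)) (sum-tabulate n f)
  where
  sum-tabulate : ∀ n (f : Fin n → ℕ) → sum (tabulate f) ≡ ∑ n f
  sum-tabulate zero    f = refl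
  sum-tabulate (suc n) f = cong (f zero +_) (sum-tabulate n (f ∘ suc))

sum-concatMap : ∀ {A : Set} (g : A → List ℕ) (xs : List A) →
                sum (concatMap g xs) ≡ sum (map (sum ∘ g) xs)
sum-concatMap g []       = refl
sum-concatMap g (x ∷ xs) = trans (sum-++ (g x) (concatMap g xs)) (cong (sum (g x) +_) (sum-concatMap g xs))

∑-cong : ∀ n {f g : Fin n → ℕ} → (∀ i → f i ≡ g i) → ∑ n f ≡ ∑ n g
∑-cong zero    e = refl
∑-cong (suc n) e = cong₂ _+_ (e zero) (∑-cong n (e ∘ suc))

∑-mono : ∀ n {f g : Fin n → ℕ} → (∀ i → f i ≤ g i) → ∑ n f ≤ ∑ n g
∑-mono zero    e = z≤n
∑-mono (suc n) e = +-mono-≤ (e zero) (∑-mono n (e ∘ suc))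

∑-+ : ∀ n (f g : Fin n → ℕ) → ∑ n (λ i → f i + g i) ≡ ∑ n f + ∑ n g
∑-+ zero    f g = refl
∑-+ (suc n) f g = trans (cong (f zero + g zero +_) (∑-+ n (f ∘ suc) (g ∘ suc)))
                        (+-interchange (f zero) (g zero) _ _)

∑-zero : ∀ n → ∑ n (λ _ → 0) ≡ 0
∑-zero zero    = refl
∑-zero (suc n) = ∑-zero n

∑-swap : ∀ m n (f : Fin m → Fin n → ℕ) →
         ∑ m (λ i → ∑ n (f i)) ≡ ∑ n (λ j → ∑ m (λ i → f i j))
∑-swap zero    n f = sym (∑-zero n)
∑-swap (suc m) n f = trans (cong (∑ n (f zero) +_) (∑-swap m n (f ∘ suc)))
                           (sym (∑-+ n (f zero) (λ j → ∑ m (λ i → f (suc i) j))))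

term≤∑ : ∀ n (f : Fin n → ℕ) v → f v ≤ ∑ n f
term≤∑ (suc n) f zero    = m≤m+n _ _
term≤∑ (suc n) f (suc v) = ≤-trans (term≤∑ n (f ∘ suc) v) (m≤n+m _ (f zero))

∑-if : ∀ n (b : Bool) (f : Fin n → ℕ) → ∑ n (λ j → if b then f j else 0) ≡ (if b then ∑ n f else 0)
∑-if n true  f = refl
∑-if n false f = ∑-zero n

∑-scale : ∀ n (Z : Fin n → Bool) c → ∑ n (λ a → if Z a then c else 0) ≡ size Z * c
∑-scale zero    Z c = refl
∑-scale (suc n) Z c with Z zero
... | true  = cong (c +_) (∑-scale n (Z ∘ suc) c)
... | false = ∑-scale n (Z ∘ suc) c

∑-ones : ∀ n → ∑ n (λ _ → 1) ≡ n
∑-ones zero    = refl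
∑-ones (suc n) = cong suc (∑-ones n)

_==_ : ∀ {n} → Fin n → Fin n → Bool
i == j = does (i ≟F j)

==-refl : ∀ {n} (i : Fin n) → (i == i) ≡ true
==-refl i with i ≟F i
... | yes _  = refl
... | no i≢i = ⊥-elim (i≢i refl)

∑-pick : ∀ n (g : Fin n → ℕ) v → ∑ n (λ i → if i == v then g i else 0) ≡ g v
∑-pick (suc n) g zero    = trans (cong (g zero +_) (∑-zero n)) (+-identityʳ _)
∑-pick (suc n) g (suc v) = ∑-pick n (g ∘ suc) v

-- A symmetric double sum with zero diagonal is twice its part above the
-- diagonal; this is how ordered pairs count unordered edges.
above : ∀ {n} → (Fin n → Fin n → ℕ) → Fin n → Fin n → ℕ
above h i j = if toℕ i <ᵇ toℕ j then h i j else 0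

∑²-symmetric : ∀ n (h : Fin n → Fin n → ℕ) → (∀ i j → h i j ≡ h j i) → (∀ i → h i i ≡ 0) →
               ∑² n h ≡ ∑² n (above h) + ∑² n (above h)
∑²-symmetric n h h-sym h-diag = begin
  ∑² n h                                                  ≡⟨ ∑-cong n (λ i → ∑-cong n (split i)) ⟩
  ∑ n (λ i → ∑ n (λ j → above h i j + above h j i))        ≡⟨ ∑-cong n (λ i → ∑-+ n _ _) ⟩
  ∑ n (λ i → ∑ n (above h i) + ∑ n (λ j → above h j i))    ≡⟨ ∑-+ n _ _ ⟩
  ∑² n (above h) + ∑ n (λ i → ∑ n (λ j → above h j i))     ≡⟨ cong (∑² n (above h) +_) (∑-swap n n _) ⟩
  ∑² n (above h) + ∑² n (above h)                          ∎
  where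
  open ≡-Reasoning
  <ᵇ-false : ∀ {a b} → (a <ᵇ b) ≡ false → b ≤ a
  <ᵇ-false eq = ≮⇒≥ (λ lt → subst T eq (<⇒<ᵇ lt))
  <ᵇ-true : ∀ {a b} → (a <ᵇ b) ≡ true → a < b
  <ᵇ-true {a} {b} eq = <ᵇ⇒< a b (subst T (sym eq) tt)
  split : ∀ i j → h i j ≡ above h i j + above h j i
  split i j with toℕ i <ᵇ toℕ j in ij | toℕ j <ᵇ toℕ i in ji
  ... | true  | true  = ⊥-elim (<-asym (<ᵇ-true {toℕ i} ij) (<ᵇ-true {toℕ j} ji))
  ... | true  | false = sym (+-identityʳ _)
  ... | false | true  = h-sym i j
  ... | false | false = trans (cong (h i) (sym i≡j)) (h-diag i)
    where i≡j = toℕ-injective (≤-antisym (<ᵇ-false {toℕ j} ji) (<ᵇ-false {toℕ i} ij))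

if-∧ : ∀ b c → indicator (b ∧ c) ≡ (if b then indicator c else 0)
if-∧ true  c = refl
if-∧ false c = refl

half : ∀ {a b} → a + a ≤ b + b → a ≤ b
half {a} {b} a+a≤b+b with a ≤? b
... | yes a≤b = a≤b
... | no  a≰b = ⊥-elim (<⇒≱ (+-mono-< (≰⇒> a≰b) (≰⇒> a≰b)) a+a≤b+b)

-- A vertex with i < p neighbours inside Z and degree ≥ d ≥ p has more
-- than d − p neighbours outside.
excess : ∀ {d i o p} → d ≤ i + o → i < p → p ≤ d → suc (d ∸ p) ≤ o
excess {d} {i} {o} {p} d≤i+o i<p p≤d = +-cancelʳ-< p (d ∸ p) o (begin-strict
  d ∸ p + p ≡⟨ m∸n+n≡m p≤d ⟩
  d         ≤⟨ d≤i+o ⟩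
  i + o     <⟨ +-monoˡ-< o i<p ⟩
  p + o     ≡⟨ +-comm p o ⟩
  o + p     ∎)
  where open ≤-Reasoning

covers : ∀ {p d} → 1 ≤ p → p ≤ d → d ≤ p * suc (d ∸ p)
covers {p} {d} 1≤p p≤d = begin
  d                 ≡⟨ m+[n∸m]≡n p≤d ⟨
  p + (d ∸ p)       ≤⟨ +-monoʳ-≤ p (≤-trans (≤-reflexive (sym (*-identityˡ (d ∸ p)))) (*-monoˡ-≤ (d ∸ p) 1≤p)) ⟩
  p + p * (d ∸ p)   ≡⟨ *-suc p (d ∸ p) ⟨
  p * suc (d ∸ p)   ∎
  where open ≤-Reasoning

true≢false : true ≢ false
true≢false ()

not-true : ∀ {x} → not x ≡ true → x ≡ false
not-true {false} _ = refl

reach-++ : ∀ {m} {a : Fin m → Fin m → Bool} {u w v} → Reach a u w → Reach a w v → Reach a u v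
reach-++ here       q = q
reach-++ (step e p) q = step e (reach-++ p q)

reach-snoc : ∀ {m} {a : Fin m → Fin m → Bool} {u w v} → Reach a u w → a w v ≡ true → Reach a u v
reach-snoc p e = reach-++ p (step e here)

reach-reverse : (G : Graph) → ∀ {u v} → Reach (adj G) u v → Reach (adj G) v u
reach-reverse G here                         = here
reach-reverse G (step {u = u} {w = w} e r) = reach-snoc (reach-reverse G r) (trans (Graph.sym G w u) e)

reach-closed : ∀ {m} {a : Fin m → Fin m → Bool} (P : Fin m → Bool) →
               (∀ x y → P x ≡ true → a x y ≡ true → P y ≡ true) →
               ∀ {u v} → Reach a u v → P u ≡ true → P v ≡ true
reach-closed P closed here       pu = pu
reach-closed P closed (step e r) pu = reach-closed P closed r (closed _ _ pu e)

exit-edge : ∀ {m} {a : Fin m → Fin m → Bool} (Z : Fin m → Bool) → ∀ {u v} → Reach a u v →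
            Z u ≡ true → Z v ≡ false →
            Σ (Fin m) λ x → Σ (Fin m) λ y → Z x ≡ true × Z y ≡ false × a x y ≡ true
exit-edge Z here zu zv = ⊥-elim (true≢false (trans (sym zu) zv))
exit-edge Z (step {w = w} e r) zu zv with Z w in zw
... | true  = exit-edge Z r zw zv
... | false = _ , _ , zu , zw , e

hub-connected : (G : Graph) → 0 < n G → (h : Fin (n G)) → (∀ u → Reach (adj G) u h) → Connected G
hub-connected G pos h toHub = pos , λ u v → reach-++ (toHub u) (reach-reverse G (toHub v))

≼-trans : ∀ {S T G} → S ≼ T → T ≼ G → S ≼ G
≼-trans (f , f-inj , f-adj) (g , g-inj , g-adj) =
  g ∘ f , f-inj ∘ g-inj , λ i j → trans (f-adj i j) (g-adj (f i) (f j))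

-- Existence of a map Fin m → Fin k with an extensional decidable property is
-- decidable: enumerate the image of zero and recurse.
◂-cong : ∀ {m k} {x : Fin k} {f g : Fin m → Fin k} → (∀ i → f i ≡ g i) → ∀ i → (x ◂ f) i ≡ (x ◂ g) i
◂-cong e zero    = refl
◂-cong e (suc i) = e i

any-map? : ∀ m k (P : (Fin m → Fin k) → Set) → (∀ f g → (∀ i → f i ≡ g i) → P f → P g) →
           (∀ f → Dec (P f)) → Dec (Σ _ P)
any-map? zero k P ext P? with P? (λ ())
... | yes p = yes (_ , p)
... | no ¬p = no λ (f , pf) → ¬p (ext f _ (λ ()) pf)
any-map? (suc m) k P ext P?
  with any? (λ x → any-map? m k (P ∘ (x ◂_)) (λ f g e → ext (x ◂ f) (x ◂ g) (◂-cong e)) (P? ∘ (x ◂_)))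
... | yes (x , g , p) = yes (_ , p)
... | no ¬p = no λ (f , pf) → ¬p (f zero , f ∘ suc , ext f _ (λ { zero → refl ; (suc i) → refl }) pf)

_≼?_ : (S T : Graph) → Dec (S ≼ T)
S ≼? T = any-map? (n S) (n T) _ ext embedding?
  where
  ext : ∀ f g → (∀ i → f i ≡ g i) →
        Injective _≡_ _≡_ f × (∀ i j → adj S i j ≡ adj T (f i) (f j)) →
        Injective _≡_ _≡_ g × (∀ i j → adj S i j ≡ adj T (g i) (g j))
  ext f g e (f-inj , f-adj) = (λ {x} {y} eq → f-inj (trans (e x) (trans eq (sym (e y))))) ,
                              (λ i j → trans (f-adj i j) (cong₂ (adj T) (e i) (e j)))
  embedding? : ∀ f → Dec (Injective _≡_ _≡_ f × (∀ i j → adj S i j ≡ adj T (f i) (f j)))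
  embedding? f = injective? ×-dec all? (λ i → all? (λ j → adj S i j ≟B adj T (f i) (f j)))
    where
    injective? : Dec (Injective _≡_ _≡_ f)
    injective? with all? (λ x → all? (λ y → (f x ≟F f y) →-dec (x ≟F y)))
    ... | yes h = yes (λ {x} {y} → h x y)
    ... | no ¬h = no (λ inj → ¬h (λ x y → inj))

Marker : Graph → Set
Marker G = Fin (n G) → Fin (n G) → Bool

module Counting (G : Graph) where
  N : ℕ
  N = n G

  edge : Fin N → Fin N → ℕ
  edge a b = indicator (adj G a b)

  edge-sym : ∀ a b → edge a b ≡ edge b a
  edge-sym a b = cong indicator (Graph.sym G a b)

  deg≡∑ : ∀ v → deg G v ≡ ∑ N (edge v)
  deg≡∑ v = sum-allFin N (edge v)

  removed : Marker G → Fin N → Fin N → ℕ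
  removed F i j = indicator (marked G F i j)

  marked-sym : ∀ F i j → marked G F i j ≡ marked G F j i
  marked-sym F i j = cong₂ _∧_ (Graph.sym G i j) (∨-comm (F i j) (F j i))

  removed-twice : ∀ F → ∑² N (removed F) ≡ removedCount G F + removedCount G F
  removed-twice F = begin
    ∑² N (removed F)
      ≡⟨ ∑²-symmetric N (removed F) (λ i j → cong indicator (marked-sym F i j)) diagonal ⟩
    ∑² N (above (removed F)) + ∑² N (above (removed F))
      ≡⟨ cong₂ _+_ removedCount≡ removedCount≡ ⟨
    removedCount G F + removedCount G F ∎
    where
    open ≡-Reasoning
    diagonal : ∀ i → removed F i i ≡ 0
    diagonal i rewrite Graph.irr G i = refl
    removedCount≡ : removedCount G F ≡ ∑² N (above (removed F))
    removedCount≡ =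
      trans (sum-concatMap _ (allFin N))
        (trans (sum-allFin N _)
          (∑-cong N λ i → trans (sum-allFin N _)
            (∑-cong N λ j → if-∧ (toℕ i <ᵇ toℕ j) (marked G F i j))))

  leaving : (Fin N → Bool) → Fin N → Fin N → ℕ
  leaving Z a b = if Z a then (if Z b then 0 else edge a b) else 0

  ∂ : (Fin N → Bool) → ℕ
  ∂ Z = ∑² N (leaving Z)

  ∂-complement : ∀ Z → ∂ Z ≡ ∂ (not ∘ Z)
  ∂-complement Z =
    trans (∑-cong N λ a → ∑-cong N λ b → reversed (Z a) (Z b) (edge-sym a b)) (∑-swap N N _)
    where
    reversed : ∀ x y {e e'} → e ≡ e' →
               (if x then (if y then 0 else e) else 0) ≡ (if not y then (if not x then 0 else e') else 0)
    reversed true  true  eq = refl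
    reversed true  false eq = eq
    reversed false true  eq = refl
    reversed false false eq = refl

  CutsOff : Marker G → (Fin N → Bool) → Set
  CutsOff F Z = ∀ a b → Z a ≡ true → Z b ≡ false → adj G a b ≡ true → marked G F a b ≡ true

  ∂≤removedCount : ∀ F Z → CutsOff F Z → ∂ Z ≤ removedCount G F
  ∂≤removedCount F Z cuts = half (begin
    ∂ Z + ∂ Z                                           ≡⟨ both-directions ⟨
    ∑² N (λ a b → leaving Z a b + leaving Z b a)        ≤⟨ ∑-mono N (λ a → ∑-mono N (pair a)) ⟩
    ∑² N (removed F)                                    ≡⟨ removed-twice F ⟩
    removedCount G F + removedCount G F                 ∎)
    where
    open ≤-Reasoning
    both-directions : ∑² N (λ a b → leaving Z a b + leaving Z b a) ≡ ∂ Z + ∂ Z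
    both-directions = trans (∑-cong N (λ a → ∑-+ N _ _))
                        (trans (∑-+ N _ _) (cong (∂ Z +_) (∑-swap N N (λ a b → leaving Z b a))))
    edge≤removed : ∀ a b → (adj G a b ≡ true → marked G F a b ≡ true) → edge a b ≤ removed F a b
    edge≤removed a b h with adj G a b in ab
    ... | false = z≤n
    ... | true rewrite h refl = ≤-refl
    pair : ∀ a b → leaving Z a b + leaving Z b a ≤ removed F a b
    pair a b with Z a in za | Z b in zb
    ... | true  | true  = z≤n
    ... | false | false = z≤n
    ... | true  | false = subst (_≤ removed F a b) (sym (+-identityʳ _)) (edge≤removed a b (cuts a b za zb))
    ... | false | true  = subst (edge b a ≤_) (cong indicator (marked-sym F b a)) (edge≤removed b a (cuts b a zb za))

  inside outside : (Fin N → Bool) → Fin N → ℕ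
  inside  Z a = ∑ N (λ b → if Z b then edge a b else 0)
  outside Z a = ∑ N (λ b → if Z b then 0 else edge a b)

  deg-split : ∀ Z a → deg G a ≡ inside Z a + outside Z a
  deg-split Z a = trans (deg≡∑ a) (trans (∑-cong N (λ b → split (Z b) (edge a b))) (∑-+ N _ _))
    where
    split : ∀ x e → e ≡ (if x then e else 0) + (if x then 0 else e)
    split true  e = sym (+-identityʳ e)
    split false e = refl

  -- A vertex of Z is not its own neighbour, so it has fewer than |Z|
  -- neighbours inside Z.
  inside<size : ∀ Z a → Z a ≡ true → inside Z a < size Z
  inside<size Z a za = subst (_≤ size Z) inside+1 (∑-mono N pointwise)
    where
    inside+1 : ∑ N (λ b → (if Z b then edge a b else 0) + indicator (b == a)) ≡ suc (inside Z a)
    inside+1 = trans (∑-+ N _ _) (trans (cong (inside Z a +_) (∑-pick N (λ _ → 1) a)) (+-comm _ 1))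
    pointwise : ∀ b → (if Z b then edge a b else 0) + indicator (b == a) ≤ indicator (Z b)
    pointwise b with b ≟F a
    pointwise b | yes refl rewrite za | Graph.irr G b = ≤-refl
    pointwise b | no _ with Z b
    ... | false = z≤n
    ... | true  = subst (_≤ 1) (sym (+-identityʳ _)) (indicator≤1 (adj G a b))
      where
      indicator≤1 : ∀ x → indicator x ≤ 1
      indicator≤1 true  = ≤-refl
      indicator≤1 false = z≤n

  deg<N : ∀ v → deg G v < N
  deg<N v = subst₂ _<_ (sym (deg≡∑ v)) (∑-ones N) (inside<size (λ _ → true) v refl)

  ∂-rows : ∀ Z → ∂ Z ≡ ∑ N (λ a → if Z a then outside Z a else 0)
  ∂-rows Z = ∑-cong N (λ a → ∑-if N (Z a) (λ b → if Z b then 0 else edge a b))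

  outside-edge : ∀ Z a b → Z b ≡ false → adj G a b ≡ true → 1 ≤ outside Z a
  outside-edge Z a b zb ab = ≤-trans (≤-reflexive (sym term≡1)) (term≤∑ N _ b)
    where
    term≡1 : (if Z b then 0 else edge a b) ≡ 1
    term≡1 rewrite zb | ab = refl

  ∂-lower : ∀ Z m → (∀ a → Z a ≡ true → m ≤ outside Z a) → size Z * m ≤ ∂ Z
  ∂-lower Z m many = begin
    size Z * m                                  ≡⟨ ∑-scale N Z m ⟨
    ∑ N (λ a → if Z a then m else 0)            ≤⟨ ∑-mono N pointwise ⟩
    ∑ N (λ a → if Z a then outside Z a else 0)  ≡⟨ ∂-rows Z ⟨
    ∂ Z                                         ∎
    where
    open ≤-Reasoning
    pointwise : ∀ a → (if Z a then m else 0) ≤ (if Z a then outside Z a else 0)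
    pointwise a with Z a in za
    ... | true  = many a za
    ... | false = z≤n

  ExitsFrom : (Fin N → Bool) → Fin N → Set
  ExitsFrom Z a = Z a ≡ true → Σ (Fin N) λ b → Z b ≡ false × adj G a b ≡ true

  Exits : (Fin N → Bool) → Set
  Exits Z = ∀ a → ExitsFrom Z a

  -- The key estimate: if all degrees are ≥ d and every vertex of the nonempty
  -- set Z has a neighbour outside, then |∂Z| ≥ |Z| · max(1, d − |Z| + 1) ≥ d.
  ∂-bound : ∀ Z d → (∀ v → d ≤ deg G v) → (∃ λ x → Z x ≡ true) → Exits Z → d ≤ ∂ Z
  ∂-bound Z d degrees≥d (x , zx) exits with d ≤? size Z
  ... | yes d≤|Z| = ≤-trans d≤|Z| (subst (_≤ ∂ Z) (*-identityʳ (size Z)) (∂-lower Z 1 one-out))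
    where
    one-out : ∀ a → Z a ≡ true → 1 ≤ outside Z a
    one-out a za = let (b , zb , ab) = exits a za in outside-edge Z a b zb ab
  ... | no d≰|Z| = ≤-trans (covers 1≤|Z| |Z|≤d) (∂-lower Z _ many-out)
    where
    |Z|≤d = <⇒≤ (≰⇒> d≰|Z|)
    1≤|Z| : 1 ≤ size Z
    1≤|Z| = ≤-trans (≤-reflexive (cong indicator (sym zx))) (term≤∑ N (indicator ∘ Z) x)
    many-out : ∀ a → Z a ≡ true → suc (d ∸ size Z) ≤ outside Z a
    many-out a za = excess (≤-trans (degrees≥d a) (≤-reflexive (deg-split Z a))) (inside<size Z a za) |Z|≤d

  ∂-connected : Connected G → ∀ Z → (∃ λ x → Z x ≡ true) → (∃ λ y → Z y ≡ false) → 1 ≤ ∂ Z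
  ∂-connected (_ , walk) Z (x , zx) (y , zy) with exit-edge Z (walk x y) zx zy
  ... | a , b , za , zb , ab = begin
    1                                           ≤⟨ outside-edge Z a b zb ab ⟩
    outside Z a                                 ≡⟨ cong (λ z → if z then outside Z a else 0) za ⟨
    (if Z a then outside Z a else 0)            ≤⟨ term≤∑ N _ a ⟩
    ∑ N (λ a → if Z a then outside Z a else 0)  ≡⟨ ∂-rows Z ⟨
    ∂ Z                                         ∎
    where open ≤-Reasoning

  BoundaryAtLeast : ℕ → Set
  BoundaryAtLeast Q = ∀ Z → (∃ λ x → Z x ≡ true) → (∃ λ y → Z y ≡ false) → Q ≤ ∂ Z

  Separation : Marker G → Set
  Separation F = Σ (Fin N → Bool) λ Z → (∃ λ x → Z x ≡ true) × (∃ λ y → Z y ≡ false) × CutsOff F Z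

  -- If F disconnects G, then (classically) the set of vertices reachable
  -- from some u in G − F is a separation.
  separation : ∀ F → 0 < N → Disconnects G F → ¬ ¬ Separation F
  separation F pos disconnected noSeparation =
    ¬¬-all {P = λ u → ∀ v → R u v} (λ u → ¬¬-all {P = R u} λ v ¬uv →
      ¬¬-all {P = λ w → Dec (R u w)} (λ _ → ¬¬-excluded-middle) λ reach? →
        noSeparation (component reach? ¬uv))
    λ walks → disconnected (pos , walks)
    where
    R = Reach (deleteAdj G F)
    component : ∀ {u v} → (∀ w → Dec (R u w)) → ¬ R u v → Separation F
    component {u} {v} reach? ¬uv = Z , (u , in-Z here) , (v , out-Z ¬uv) , cuts
      where
      Z : Fin N → Bool
      Z w = does (reach? w)
      in-Z : ∀ {w} → R u w → Z w ≡ true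
      in-Z {w} r with reach? w
      ... | yes _ = refl
      ... | no ¬r = ⊥-elim (¬r r)
      out-Z : ∀ {w} → ¬ R u w → Z w ≡ false
      out-Z {w} ¬r with reach? w
      ... | yes r = ⊥-elim (¬r r)
      ... | no _  = refl
      reached : ∀ {w} → Z w ≡ true → R u w
      reached {w} zw with reach? w
      ... | yes r = r
      cuts : CutsOff F Z
      cuts a b za zb ab with F a b ∨ F b a in removedAB
      ... | true  = trans (∧-identityʳ _) ab
      ... | false = ⊥-elim (true≢false (trans (sym (in-Z (reach-snoc (reached za) kept))) zb))
        where
        kept : deleteAdj G F a b ≡ true
        kept = cong₂ _∧_ ab (cong not removedAB)

  cut-bound : ∀ {Q} → 0 < N → BoundaryAtLeast Q → ∀ F → Disconnects G F → Q ≤ removedCount G F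
  cut-bound {Q} pos bound F disconnected =
    decidable-stable (Q ≤? removedCount G F) (¬¬-map via-∂ (separation F pos disconnected))
    where
    via-∂ : Separation F → Q ≤ removedCount G F
    via-∂ (Z , x , y , cuts) = ≤-trans (bound Z x y) (∂≤removedCount F Z cuts)

  star : Fin N → Marker G
  star v i j = i == v

  star-size : ∀ v → removedCount G (star v) ≤ deg G v
  star-size v = half (begin
    removedCount G (star v) + removedCount G (star v)  ≡⟨ removed-twice (star v) ⟨
    ∑² N (removed (star v))                            ≤⟨ ∑-mono N (λ i → ∑-mono N (pointwise i)) ⟩
    ∑² N (λ i j → from-v i j + to-v i j)               ≡⟨ trans (∑-cong N (λ i → ∑-+ N _ _)) (∑-+ N _ _) ⟩
    ∑² N from-v + ∑² N to-v                            ≡⟨ cong₂ _+_ out-of-v into-v ⟩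
    deg G v + deg G v                                  ∎)
    where
    open ≤-Reasoning
    from-v to-v : Fin N → Fin N → ℕ
    from-v i j = if i == v then edge i j else 0
    to-v   i j = if j == v then edge i j else 0
    pointwise : ∀ i j → removed (star v) i j ≤ from-v i j + to-v i j
    pointwise i j with adj G i j
    ... | false = z≤n
    ... | true with i == v | j == v
    ...   | true  | _     = s≤s z≤n
    ...   | false | true  = ≤-refl
    ...   | false | false = z≤n
    out-of-v : ∑² N from-v ≡ deg G v
    out-of-v = trans (∑-cong N (λ i → ∑-if N (i == v) (edge i)))
                     (trans (∑-pick N (λ i → ∑ N (edge i)) v) (sym (deg≡∑ v)))
    into-v : ∑² N to-v ≡ deg G v
    into-v = trans (∑-cong N (λ i → trans (∑-pick N (edge i) v) (edge-sym i v))) (sym (deg≡∑ v))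

  -- Removing the star of v isolates v, so it disconnects G when G has
  -- another vertex w.
  star-disconnects : ∀ v w → w ≢ v → Disconnects G (star v)
  star-disconnects v w w≢v (_ , walk) with walk v w
  ... | here = w≢v refl
  ... | step {w = x} e _ = true≢false (begin
    true                                      ≡⟨ e ⟨
    adj G v x ∧ not ((v == v) ∨ (x == v))     ≡⟨ cong (λ b → adj G v x ∧ not (b ∨ (x == v))) (==-refl v) ⟩
    adj G v x ∧ false                         ≡⟨ ∧-zeroʳ (adj G v x) ⟩
    false                                     ∎)
    where open ≡-Reasoning

  Stuck : (Fin N → Bool) → Set
  Stuck Z = Σ (Fin N) λ a → Z a ≡ true × (∀ b → adj G a b ≡ true → Z b ≡ true)

  exits-from? : ∀ Z a → Dec (ExitsFrom Z a)
  exits-from? Z a = (Z a ≟B true) →-dec any? (λ b → (Z b ≟B false) ×-dec (adj G a b ≟B true))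

  exits-or-stuck : ∀ Z → Exits Z ⊎ Stuck Z
  exits-or-stuck Z with all? (exits-from? Z)
  ... | yes exits = inj₁ exits
  ... | no ¬exits with ¬∀⟶∃¬ N (ExitsFrom Z) (exits-from? Z) ¬exits
  ...   | a , ¬exit with Z a in za
  ...     | false = ⊥-elim (¬exit λ ())
  ...     | true  = inj₂ (a , za , inside-Z)
    where
    inside-Z : ∀ b → adj G a b ≡ true → Z b ≡ true
    inside-Z b ab with Z b in zb
    ... | true  = refl
    ... | false = ⊥-elim (¬exit λ _ → b , zb , ab)

  other-vertex : ∀ F → Disconnects G F → (v : Fin N) → ∃ λ w → w ≢ v
  other-vertex F disconnected v with any? (λ w → ¬? (w ≟F v))
  ... | yes found = found
  ... | no none   = ⊥-elim (disconnected (≤-trans (s≤s z≤n) (toℕ<n v) , walk))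
    where
    only-v : ∀ w → w ≡ v
    only-v w = decidable-stable (w ≟F v) (λ w≢v → none (w , w≢v))
    walk : ∀ u u' → Reach (deleteAdj G F) u u'
    walk u u' rewrite only-v u | only-v u' = here

-- P₄ has no two vertices with the same neighbourhood, hence every map out
-- of P₄ preserving and reflecting adjacency is injective.
P₄-twin-free : ∀ i j → (∀ k → p4adj i k ≡ p4adj j k) → i ≡ j
P₄-twin-free = from-yes (all? λ i → all? λ j → all? (λ k → p4adj i k ≟B p4adj j k) →-dec (i ≟F j))

induced-P₄ : (G : Graph) → ∀ a b c e →
             adj G a b ≡ true → adj G b c ≡ true → adj G c e ≡ true →
             adj G a c ≡ false → adj G b e ≡ false → adj G a e ≡ false → P₄ ≼ G
induced-P₄ G a b c e ab bc ce ac be ae = f , injective , table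
  where
  f : Fin 4 → Fin (n G)
  f zero                   = a
  f (suc zero)             = b
  f (suc (suc zero))       = c
  f (suc (suc (suc zero))) = e
  reversed : ∀ {x y} {v} → adj G x y ≡ v → v ≡ adj G y x
  reversed {x} {y} xy = sym (trans (Graph.sym G y x) xy)
  table : ∀ i j → p4adj i j ≡ adj G (f i) (f j)
  table zero                   zero                   = sym (Graph.irr G a)
  table zero                   (suc zero)             = sym ab
  table zero                   (suc (suc zero))       = sym ac
  table zero                   (suc (suc (suc zero))) = sym ae
  table (suc zero)             zero                   = reversed ab
  table (suc zero)             (suc zero)             = sym (Graph.irr G b)
  table (suc zero)             (suc (suc zero))       = sym bc
  table (suc zero)             (suc (suc (suc zero))) = sym be
  table (suc (suc zero))       zero                   = reversed ac
  table (suc (suc zero))       (suc zero)             = reversed bc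
  table (suc (suc zero))       (suc (suc zero))       = sym (Graph.irr G c)
  table (suc (suc zero))       (suc (suc (suc zero))) = sym ce
  table (suc (suc (suc zero))) zero                   = reversed ae
  table (suc (suc (suc zero))) (suc zero)             = reversed be
  table (suc (suc (suc zero))) (suc (suc zero))       = reversed ce
  table (suc (suc (suc zero))) (suc (suc (suc zero))) = sym (Graph.irr G e)
  injective : Injective _≡_ _≡_ f
  injective {i} {j} fi≡fj =
    P₄-twin-free i j (λ k → trans (table i k) (trans (cong (λ z → adj G z (f k)) fi≡fj) (sym (table j k))))

Within2 : (G : Graph) → Fin (n G) → Fin (n G) → Set
Within2 G x w = x ≡ w ⊎ adj G x w ≡ true ⊎ Σ (Fin (n G)) λ c → adj G x c ≡ true × adj G c w ≡ true

-- In a P₄-free graph, walks can be shortened to length ≤ 2: if x ~ x' and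
-- x' is within distance 2 of w but x is not, then x x' c w is an induced P₄.
within2 : (G : Graph) → Free P₄ G → ∀ {x w} → Reach (adj G) x w → Within2 G x w
within2 G free {x} {w} walk with x ≟F w
... | yes x≡w = inj₁ x≡w
... | no  x≢w with adj G x w in xw
...   | true  = inj₂ (inj₁ refl)
...   | false with any? (λ c → (adj G x c ≟B true) ×-dec (adj G c w ≟B true))
...     | yes common = inj₂ (inj₂ common)
...     | no ¬common = ⊥-elim (shorten walk)
  where
  non-edge : ∀ {y z} → ¬ (adj G y z ≡ true) → adj G y z ≡ false
  non-edge {y} {z} ¬yz with adj G y z
  ... | true  = ⊥-elim (¬yz refl)
  ... | false = refl
  shorten : Reach (adj G) x w → ⊥
  shorten here = x≢w refl
  shorten (step {w = x'} xx' walk') with within2 G free walk'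
  ... | inj₁ refl = true≢false (trans (sym xx') xw)
  ... | inj₂ (inj₁ x'w) = ¬common (x' , xx' , x'w)
  ... | inj₂ (inj₂ (c , x'c , cw)) =
    free (induced-P₄ G x x' c w xx' x'c cw
            (non-edge λ xc → ¬common (c , xc , cw)) (non-edge λ x'w → ¬common (x' , xx' , x'w)) xw)

module _ (G : Graph) where
  open Counting G

  -- In a connected P₄-free graph with all degrees ≥ d, every nonempty proper
  -- vertex set Z has ≥ d boundary edges: otherwise both Z and its complement
  -- contain a vertex with no neighbour on the other side, and these two
  -- vertices are at distance > 2.
  P₄-free-boundary : Connected G → Free P₄ G → ∀ d → (∀ v → d ≤ deg G v) → BoundaryAtLeast d
  P₄-free-boundary (_ , walk) free d degrees≥d Z (x , zx) (y , zy)
    with exits-or-stuck Z | exits-or-stuck (not ∘ Z)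
  ... | inj₁ exits | _ = ∂-bound Z d degrees≥d (x , zx) exits
  ... | inj₂ _ | inj₁ exits =
    subst (d ≤_) (sym (∂-complement Z)) (∂-bound (not ∘ Z) d degrees≥d (y , cong not zy) exits)
  ... | inj₂ (a , za , a-inside) | inj₂ (b , zb , b-outside) with within2 G free (walk a b)
  ... | inj₁ refl = ⊥-elim (true≢false (trans (sym za) (not-true zb)))
  ... | inj₂ (inj₁ ab) = ⊥-elim (true≢false (trans (sym (a-inside b ab)) (not-true zb)))
  ... | inj₂ (inj₂ (c , ac , cb)) =
    ⊥-elim (true≢false (trans (sym (a-inside c ac)) (not-true (b-outside c (trans (Graph.sym G b c) cb)))))

  -- Connected P₄-free graphs have κ' = δ: the star of a vertex of minimum
  -- degree gives κ' ≤ δ, and the boundary bound gives κ' ≥ δ.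
  P₄-free⇒κ'≡δ : Connected G → Free P₄ G → EdgeConnEqMinDeg G
  P₄-free⇒κ'≡δ _ _ k d (inj₂ (n≡1 , k≡0)) ((v , deg-v≡d) , _) =
    trans k≡0 (sym (trans (sym deg-v≡d) (n<1⇒n≡0 (subst (deg G v <_) n≡1 (deg<N v)))))
  P₄-free⇒κ'≡δ connected free k d (inj₁ ((F , disconnected , |F|≡k) , minimal)) ((v , deg-v≡d) , degrees≥d) =
    ≤-antisym k≤d d≤k
    where
    d≤k : d ≤ k
    d≤k = subst (d ≤_) |F|≡k
            (cut-bound (proj₁ connected) (P₄-free-boundary connected free d degrees≥d) F disconnected)
    k≤d : k ≤ d
    k≤d with other-vertex F disconnected v
    ... | w , w≢v = ≤-trans (minimal (star v) (star-disconnects v w w≢v)) (subst (_ ≤_) deg-v≡d (star-size v))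

closed-set-disconnects : (G : Graph) (F : Marker G) (P : Fin (n G) → Bool) →
                         (∀ x y → P x ≡ true → deleteAdj G F x y ≡ true → P y ≡ true) →
                         ∀ u v → P u ≡ true → P v ≡ false → Disconnects G F
closed-set-disconnects G F P closed u v pu pv (_ , walk) =
  true≢false (trans (sym (reach-closed P closed (walk u v) pu)) pv)

bridge-counterexample : (G : Graph) → Connected G → IsMinDegree G 2 →
                        (F : Marker G) → Disconnects G F → removedCount G F ≡ 1 → ¬ EdgeConnEqMinDeg G
bridge-counterexample G connected δ≡2 F disconnected |F|≡1 κ'≡δ with κ'≡δ 1 2 κ'≡1 δ≡2
  where
  open Counting G
  κ'≡1 : IsEdgeConnectivity G 1
  κ'≡1 = inj₁ ((F , disconnected , |F|≡1) ,
               cut-bound (proj₁ connected) (∂-connected connected))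
... | ()

fromEdges : (m : ℕ) (e : ℕ → ℕ → Bool) → (∀ (i : Fin m) → e (toℕ i) (toℕ i) ≡ false) → Graph
fromEdges m e loopless = record
  { n   = m
  ; adj = λ i j → e (toℕ i) (toℕ j) ∨ e (toℕ j) (toℕ i)
  ; sym = λ i j → ∨-comm (e (toℕ i) (toℕ j)) (e (toℕ j) (toℕ i))
  ; irr = λ i → cong (λ b → b ∨ b) (loopless i)
  }

two-triangles-edges : ℕ → ℕ → Bool
two-triangles-edges 0 1 = true
two-triangles-edges 0 2 = true
two-triangles-edges 1 2 = true
two-triangles-edges 2 3 = true
two-triangles-edges 3 4 = true
two-triangles-edges 3 5 = true
two-triangles-edges 4 5 = true
two-triangles-edges _ _ = false

TwoTriangles : Graph
TwoTriangles = fromEdges 6 two-triangles-edges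
                 (from-yes (all? {6} λ i → two-triangles-edges (toℕ i) (toℕ i) ≟B false))

two-squares-edges : ℕ → ℕ → Bool
two-squares-edges 0 1 = true
two-squares-edges 1 2 = true
two-squares-edges 2 3 = true
two-squares-edges 0 3 = true
two-squares-edges 4 5 = true
two-squares-edges 5 6 = true
two-squares-edges 6 7 = true
two-squares-edges 4 7 = true
two-squares-edges 3 4 = true
two-squares-edges _ _ = false

TwoSquares : Graph
TwoSquares = fromEdges 8 two-squares-edges
               (from-yes (all? {8} λ i → two-squares-edges (toℕ i) (toℕ i) ≟B false))

the-edge : ∀ {m} → ℕ → ℕ → Fin m → Fin m → Bool
the-edge a b i j = (toℕ i ≡ᵇ a) ∧ (toℕ j ≡ᵇ b)

two-triangles-connected : Connected TwoTriangles
two-triangles-connected = hub-connected TwoTriangles (s≤s z≤n) (# 2) to-hub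
  where
  to-hub : ∀ u → Reach (adj TwoTriangles) u (# 2)
  to-hub zero                               = step {w = # 2} refl here
  to-hub (suc zero)                         = step {w = # 2} refl here
  to-hub (suc (suc zero))                   = here
  to-hub (suc (suc (suc zero)))             = step {w = # 2} refl here
  to-hub (suc (suc (suc (suc zero))))       = step {w = # 3} refl (step {w = # 2} refl here)
  to-hub (suc (suc (suc (suc (suc zero))))) = step {w = # 3} refl (step {w = # 2} refl here)

two-triangles-counterexample : ¬ EdgeConnEqMinDeg TwoTriangles
two-triangles-counterexample =
  bridge-counterexample TwoTriangles two-triangles-connected
    ((# 0 , refl) , from-yes (all? λ v → 2 ≤? deg TwoTriangles v))
    (the-edge 2 3) (closed-set-disconnects TwoTriangles (the-edge 2 3) left closed (# 0) (# 5) refl refl) refl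
  where
  left : Fin 6 → Bool
  left x = toℕ x <ᵇ 3
  closed : ∀ x y → left x ≡ true → deleteAdj TwoTriangles (the-edge 2 3) x y ≡ true → left y ≡ true
  closed = from-yes (all? λ x → all? λ y →
             (left x ≟B true) →-dec (deleteAdj TwoTriangles (the-edge 2 3) x y ≟B true) →-dec (left y ≟B true))

two-squares-connected : Connected TwoSquares
two-squares-connected = hub-connected TwoSquares (s≤s z≤n) (# 3) to-hub
  where
  to-hub : ∀ u → Reach (adj TwoSquares) u (# 3)
  to-hub zero                                           = step {w = # 3} refl here
  to-hub (suc zero)                                     = step {w = # 2} refl (step {w = # 3} refl here)
  to-hub (suc (suc zero))                               = step {w = # 3} refl here
  to-hub (suc (suc (suc zero)))                         = here
  to-hub (suc (suc (suc (suc zero))))                   = step {w = # 3} refl here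
  to-hub (suc (suc (suc (suc (suc zero)))))             = step {w = # 4} refl (step {w = # 3} refl here)
  to-hub (suc (suc (suc (suc (suc (suc zero))))))       = step {w = # 7} refl (step {w = # 4} refl (step {w = # 3} refl here))
  to-hub (suc (suc (suc (suc (suc (suc (suc zero))))))) = step {w = # 4} refl (step {w = # 3} refl here)

two-squares-counterexample : ¬ EdgeConnEqMinDeg TwoSquares
two-squares-counterexample =
  bridge-counterexample TwoSquares two-squares-connected
    ((# 0 , refl) , from-yes (all? λ v → 2 ≤? deg TwoSquares v))
    (the-edge 3 4) (closed-set-disconnects TwoSquares (the-edge 3 4) left closed (# 0) (# 7) refl refl) refl
  where
  left : Fin 8 → Bool
  left x = toℕ x <ᵇ 4
  closed : ∀ x y → left x ≡ true → deleteAdj TwoSquares (the-edge 3 4) x y ≡ true → left y ≡ true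
  closed = from-yes (all? λ x → all? λ y →
             (left x ≟B true) →-dec (deleteAdj TwoSquares (the-edge 3 4) x y ≟B true) →-dec (left y ≟B true))

TriangleFree : Graph → Set
TriangleFree G = ∀ x y z → adj G x y ≡ true → adj G y z ≡ true → adj G x z ≡ true → ⊥

triangle-free-≼ : ∀ {S G} → S ≼ G → TriangleFree G → TriangleFree S
triangle-free-≼ (f , _ , f-adj) triangle-free x y z xy yz xz =
  triangle-free (f x) (f y) (f z) (trans (sym (f-adj x y)) xy) (trans (sym (f-adj y z)) yz) (trans (sym (f-adj x z)) xz)

two-squares-triangle-free : TriangleFree TwoSquares
two-squares-triangle-free = from-yes (all? λ x → all? λ y → all? λ z →
  (adj TwoSquares x y ≟B true) →-dec (adj TwoSquares y z ≟B true) →-dec ¬? (adj TwoSquares x z ≟B true))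

FaithfulOff : (Fin 6 → Fin 4) → (Fin 6 → Fin 6 → Bool) → Set
FaithfulOff k avoided =
  (∀ x y → avoided x y ≡ false → adj TwoTriangles x y ≡ p4adj (k x) (k y)) ×
  (∀ x y → avoided x y ≡ false → k x ≡ k y → x ≡ y)

faithfulOff? : ∀ k avoided → Dec (FaithfulOff k avoided)
faithfulOff? k avoided =
  all? (λ x → all? λ y → (avoided x y ≟B false) →-dec (adj TwoTriangles x y ≟B p4adj (k x) (k y))) ×-dec
  all? (λ x → all? λ y → (avoided x y ≟B false) →-dec (k x ≟F k y) →-dec (x ≟F y))

-- Collapse the edges {0,1} and {4,5} away from the bridge: the path {0,1}–2–3–{4,5}.
collapse : Fin 6 → Fin 4
collapse x = image (toℕ x)
  where
  image : ℕ → Fin 4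
  image 0 = # 0
  image 1 = # 0
  image 2 = # 1
  image 3 = # 2
  image _ = # 3

collapsed-pair : Fin 6 → Fin 6 → Bool
collapsed-pair x y = pair (toℕ x) (toℕ y)
  where
  pair : ℕ → ℕ → Bool
  pair 0 1 = true
  pair 1 0 = true
  pair 4 5 = true
  pair 5 4 = true
  pair _ _ = false

collapse-faithful : FaithfulOff collapse collapsed-pair
collapse-faithful = from-yes (faithfulOff? collapse collapsed-pair)

collapsed-pair-cases : ∀ x y → collapsed-pair x y ≡ true →
  ((x ≡ # 0 × y ≡ # 1) ⊎ (x ≡ # 1 × y ≡ # 0)) ⊎ ((x ≡ # 4 × y ≡ # 5) ⊎ (x ≡ # 5 × y ≡ # 4))
collapsed-pair-cases = from-yes (all? λ x → all? λ y → (collapsed-pair x y ≟B true) →-dec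
  ((((x ≟F # 0) ×-dec (y ≟F # 1)) ⊎-dec ((x ≟F # 1) ×-dec (y ≟F # 0))) ⊎-dec
   (((x ≟F # 4) ×-dec (y ≟F # 5)) ⊎-dec ((x ≟F # 5) ×-dec (y ≟F # 4)))))

left-edge right-edge : Fin 6 → Bool
left-edge  x = toℕ x <ᵇ 2
right-edge x = 3 <ᵇ toℕ x

onto-first-edge : ℕ → Fin 6 → Fin 4
onto-first-edge a x = if toℕ x ≡ᵇ a then # 1 else # 0

left-edge-faithful : FaithfulOff (onto-first-edge 1) (λ x y → not (left-edge x ∧ left-edge y))
left-edge-faithful = from-yes (faithfulOff? (onto-first-edge 1) (λ x y → not (left-edge x ∧ left-edge y)))

right-edge-faithful : FaithfulOff (onto-first-edge 5) (λ x y → not (right-edge x ∧ right-edge y))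
right-edge-faithful = from-yes (faithfulOff? (onto-first-edge 5) (λ x y → not (right-edge x ∧ right-edge y)))

left-edge-exit : ∀ x y → left-edge x ≡ true → adj TwoTriangles x y ≡ true → y ≡ # 2 ⊎ left-edge y ≡ true
left-edge-exit = from-yes (all? λ x → all? λ y → (left-edge x ≟B true) →-dec
  (adj TwoTriangles x y ≟B true) →-dec ((y ≟F # 2) ⊎-dec (left-edge y ≟B true)))

right-edge-exit : ∀ x y → right-edge x ≡ true → adj TwoTriangles x y ≡ true → y ≡ # 3 ⊎ right-edge y ≡ true
right-edge-exit = from-yes (all? λ x → all? λ y → (right-edge x ≟B true) →-dec
  (adj TwoTriangles x y ≟B true) →-dec ((y ≟F # 3) ⊎-dec (right-edge y ≟B true)))

-- A connected triangle-free induced subgraph S of TwoTriangles embeds in P₄: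
-- if its image contains the edge {0,1} it misses 2, so (being connected) it
-- is that edge; likewise for {4,5}; otherwise collapse is faithful on it.
module TriangleFreeInTwoTriangles (S : Graph) (connected : Connected S)
                                 (triangle-free : TriangleFree S) (embedding : S ≼ TwoTriangles) where
  f : Fin (n S) → Fin 6
  f = proj₁ embedding

  f-adj : ∀ i j → adj S i j ≡ adj TwoTriangles (f i) (f j)
  f-adj = proj₂ (proj₂ embedding)

  HitsImage : Fin 6 → Set
  HitsImage x = Σ (Fin (n S)) λ i → f i ≡ x

  hits? : ∀ x → Dec (HitsImage x)
  hits? x = any? (λ i → f i ≟F x)

  restrict : ∀ k avoided → FaithfulOff k avoided → (∀ i j → avoided (f i) (f j) ≡ false) → S ≼ P₄
  restrict k avoided (k-adj , k-inj) avoids =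
    k ∘ f ,
    (λ {i} {j} k∘fi≡k∘fj → proj₁ (proj₂ embedding) (k-inj (f i) (f j) (avoids i j) k∘fi≡k∘fj)) ,
    (λ i j → trans (f-adj i j) (k-adj (f i) (f j) (avoids i j)))

  no-triangle : ∀ {x y z} → HitsImage x → HitsImage y → HitsImage z →
                adj TwoTriangles x y ≡ true → adj TwoTriangles y z ≡ true → adj TwoTriangles x z ≡ true → ⊥
  no-triangle (i , refl) (j , refl) (l , refl) xy yz xz =
    triangle-free i j l (trans (f-adj i j) xy) (trans (f-adj j l) yz) (trans (f-adj i l) xz)

  trapped : (P : Fin 6 → Bool) (apex : Fin 6) →
            (∀ x y → P x ≡ true → adj TwoTriangles x y ≡ true → y ≡ apex ⊎ P y ≡ true) →
            ¬ HitsImage apex → ∀ i₀ → P (f i₀) ≡ true → ∀ i → P (f i) ≡ true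
  trapped P apex exit no-apex i₀ p₀ i = reach-closed (P ∘ f) closed (proj₂ connected i₀ i) p₀
    where
    closed : ∀ a b → P (f a) ≡ true → adj S a b ≡ true → P (f b) ≡ true
    closed a b pa ab with exit (f a) (f b) pa (trans (sym (f-adj a b)) ab)
    ... | inj₁ fb≡apex = ⊥-elim (no-apex (b , fb≡apex))
    ... | inj₂ pb      = pb

  in-edge : (P : Fin 6 → Bool) (apex x y : Fin 6) →
            (∀ u v → P u ≡ true → adj TwoTriangles u v ≡ true → v ≡ apex ⊎ P v ≡ true) →
            ∀ k → FaithfulOff k (λ u v → not (P u ∧ P v)) →
            adj TwoTriangles x y ≡ true → adj TwoTriangles y apex ≡ true → adj TwoTriangles x apex ≡ true →
            P x ≡ true → HitsImage x → HitsImage y → S ≼ P₄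
  in-edge P apex x y exit k faithful xy y-apex x-apex px hx hy with hits? apex
  ... | yes h-apex = ⊥-elim (no-triangle hx hy h-apex xy y-apex x-apex)
  ... | no ¬h-apex = restrict k _ faithful avoids
    where
    inside = trapped P apex exit ¬h-apex (proj₁ hx) (trans (cong P (proj₂ hx)) px)
    avoids : ∀ i j → not (P (f i) ∧ P (f j)) ≡ false
    avoids i j rewrite inside i | inside j = refl

  embeds : S ≼ P₄
  embeds with hits? (# 0) ×-dec hits? (# 1)
  ... | yes (h₀ , h₁) = in-edge left-edge (# 2) (# 0) (# 1) left-edge-exit _ left-edge-faithful refl refl refl refl h₀ h₁
  ... | no ¬h₀₁ with hits? (# 4) ×-dec hits? (# 5)
  ...   | yes (h₄ , h₅) = in-edge right-edge (# 3) (# 4) (# 5) right-edge-exit _ right-edge-faithful refl refl refl refl h₄ h₅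
  ...   | no ¬h₄₅ = restrict _ _ collapse-faithful avoids
    where
    avoids : ∀ i j → collapsed-pair (f i) (f j) ≡ false
    avoids i j with collapsed-pair (f i) (f j) in pair
    ... | false = refl
    ... | true with collapsed-pair-cases (f i) (f j) pair
    ...   | inj₁ (inj₁ (fi≡0 , fj≡1)) = ⊥-elim (¬h₀₁ ((i , fi≡0) , (j , fj≡1)))
    ...   | inj₁ (inj₂ (fi≡1 , fj≡0)) = ⊥-elim (¬h₀₁ ((j , fj≡0) , (i , fi≡1)))
    ...   | inj₂ (inj₁ (fi≡4 , fj≡5)) = ⊥-elim (¬h₄₅ ((i , fi≡4) , (j , fj≡5)))
    ...   | inj₂ (inj₂ (fi≡5 , fj≡4)) = ⊥-elim (¬h₄₅ ((j , fj≡4) , (i , fi≡5)))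

-- Sufficiency: an S-free graph is P₄-free when S ≼ P₄.
sufficiency : (S : Graph) → S ≼ P₄ → ∀ (G : Graph) → Connected G → Free S G → EdgeConnEqMinDeg G
sufficiency S S≼P₄ G connected S-free =
  P₄-free⇒κ'≡δ G connected (λ P₄≼G → S-free (≼-trans {S} {P₄} {G} S≼P₄ P₄≼G))

necessity : (S : Graph) → Connected S →
            (∀ (G : Graph) → Connected G → Free S G → EdgeConnEqMinDeg G) → S ≼ P₄
necessity S connected κ'≡δ-when-free = decidable-stable (S ≼? P₄) λ S⋠P₄ →
  two-triangles-counterexample (κ'≡δ-when-free TwoTriangles two-triangles-connected λ S≼TwoTriangles →
  two-squares-counterexample (κ'≡δ-when-free TwoSquares two-squares-connected λ S≼TwoSquares →
  S⋠P₄ (TriangleFreeInTwoTriangles.embeds S connected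
          (triangle-free-≼ {S} {TwoSquares} S≼TwoSquares two-squares-triangle-free) S≼TwoTriangles)))

theorem1p4 : (S : Graph) → Connected S →
             ((∀ (G : Graph) → Connected G → Free S G → EdgeConnEqMinDeg G) → S ≼ P₄)
             × (S ≼ P₄ → ∀ (G : Graph) → Connected G → Free S G → EdgeConnEqMinDeg G)
theorem1p4 S connected = necessity S connected , sufficiency S
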